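{- Let $\mathcal P=(Q,T)$ be a parameterized system with initial local state $q_0\in Q$, $Init=q_0^*$, let $F\subseteq Q^*$ be finite and $B=\{\bar c\mid\exists\bar w\in F,\ \bar w\preceq\bar c\}$. Let $U$ be the set at which the symbolic backward reachability iteration $U_0=B$, $U_{i+1}=U_i\cup Pre(U_i)$ stabilizes (i.e. $U=U_n$ with $U_{n+1}=U_n$). If $Init\cap U=\emptyset$, then there exists a finite model of $\Phi_{\mathcal P}\wedge\neg\Psi_F$.
   Context: A parameterized system is a pair $\mathcal P=(Q,T)$ of a finite set $Q$ of local states and a finite set $T$ of rules of the form $q\to q'$ or $\mathcal G: q\to q'$ ($q,q'\in Q$), with $\mathcal G$ a condition $\forall_I J$ or $\exists_I J$, $J\subseteq Q$, $I\in\{L,R,LR\}$. Configurations are words $\bar c=c_1\cdots c_n\in Q^*$. For a position $i$: $(\bar c,i)\models\forall_L J$ iff $c_k\in J$ for all $k<i$; $\forall_R J$ iff for all $k>i$; $\forall_{LR}J$ iff both; $\exists_L J$ iff $c_k\in J$ for some $k<i$; $\exists_R J$ iff for some $k>i$; $\exists_{LR}J$ iff $\exists_L J$ or $\exists_R J$. $\bar c\to_{\mathcal P}\bar c'$ iff for some position $i$ and either a rule $q\to q'$ in $T$, or a rule $\mathcal G:q\to q'$ with $(\bar c,i)\models\mathcal G$, we have $c_i=q$, $c'_i=q'$ and $c'_j=c_j$ for $j\ne i$. $\bar w\preceq\bar w'$ means $\bar w$ is a (not necessarily contiguous) subword of $\bar w'$; this is a well quasi-ordering, so the iteration stabilizes.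 Monotone abstraction: $\bar c_1\to^A_{\mathcal P}\bar c_2$ iff there is $\bar c_1'\preceq\bar c_1$ with $\bar c_1'\to_{\mathcal P}\bar c_2$. $Pre(U)=\{\bar c\mid\exists\bar c'\in U,\ \bar c\to^A_{\mathcal P}\bar c'\}$. Encoding: vocabulary has a constant for each $q\in Q$, an extra constant $e\notin Q$, binary function $*$, unary relations $In$, $R$, and a unary $P^J$ for each condition $\forall_I J$ in $T$. $\Phi_{\mathcal P}$ is the set of universal closures of: $(x*y)*z=x*(y*z)$, $e*x=x$, $x*e=x$; $In(e)$, $In(x)\to In(x*q_0)$, $In(x)\to R(x)$; for each such $J$: $P^J(e)$ and $P^J(x)\to P^J(x*q)$ for all $q\in J$; for each rule $q_1\to q_2$: $R((x*q_1)*y)\to R((x*q_2)*y)$; for $\forall_L J:q_1\to q_2$: $R((x*q_1)*y)\wedge P^J(x)\to R((x*q_2)*y)$; for $\forall_R J$: same with $P^J(y)$; for $\forall_{LR}J$: with $P^J(x)\wedge P^J(y)$; for $\exists_L J:q_1\to q_2$ and each $q\in J$: $R((x*q_1)*y)\wedge x=(z*q)*w\to R((x*q_2)*y)$; for $\exists_R J$: same with $y=(z*q)*w$; for $\exists_{LR}J$: same with $x=(z*q)*w\vee y=(z*q)*w$. For $\bar w=w_1\cdots w_n$, $\psi_{\bar w}$ is $R(x_0*w_1*x_1*\cdots*w_n*x_n)$ with distinct variables, and $\Psi_F=\exists\bar x\bigvee_{\bar w\in F}\psi_{\bar w}$ (all variables existentially quantified). -}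

module Defs where

open import Data.Nat using (ℕ; suc)
open import Data.Fin using (Fin; zero; suc)
open import Data.Fin.Subset using (Subset; _∈_)
open import Data.List using (List; []; _∷_; _++_; length; replicate)
open import Data.List.Relation.Unary.All using (All)
open import Data.List.Relation.Unary.Any using (Any)
open import Data.List.Membership.Propositional using () renaming (_∈_ to _∈ᴸ_)
open import Data.List.Relation.Binary.Sublist.Propositional using () renaming (_⊆_ to _≼_)
open import Data.Maybe using (Maybe; just; nothing)
open import Data.Product using (Σ; ∃; _×_; _,_)
open import Data.Sum using (_⊎_)
open import Data.Empty using (⊥)
open import Data.Unit using (⊤)
open import Relation.Binary.PropositionalEquality using (_≡_)
open import Relation.Nullary using (¬_)

data Side : Set where
  L R LR : Side

data Cond (n : ℕ) : Set where
  all∀ : Side → Subset n → Cond n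
  ex∃  : Side → Subset n → Cond n

record Rule (n : ℕ) : Set where
  constructor rule
  field
    guard : Maybe (Cond n)
    src   : Fin n
    tgt   : Fin n
open Rule public

record ParamSystem (n : ℕ) : Set where
  constructor ⟨_⟩
  field
    rules : List (Rule n)
open ParamSystem public

Config : ℕ → Set
Config n = List (Fin n)

-- Semantics of conditions.  A position i of c splits c as  l ++ c_i ∷ r,
-- where l are the positions k < i and r the positions k > i.

InJ : ∀ {n} → Subset n → Fin n → Set
InJ J q = q ∈ J

holds : ∀ {n} → Cond n → Config n → Config n → Set
holds (all∀ L  J) l r = All (InJ J) l
holds (all∀ R  J) l r = All (InJ J) r
holds (all∀ LR J) l r = All (InJ J) l × All (InJ J) r
holds (ex∃  L  J) l r = Any (InJ J) l
holds (ex∃  R  J) l r = Any (InJ J) r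
holds (ex∃  LR J) l r = Any (InJ J) l ⊎ Any (InJ J) r

guardHolds : ∀ {n} → Maybe (Cond n) → Config n → Config n → Set
guardHolds nothing  l r = ⊤
guardHolds (just g) l r = holds g l r

_⊢_⟶_ : ∀ {n} → ParamSystem n → Config n → Config n → Set
P ⊢ c ⟶ c' =
  Σ (Rule _) λ t → t ∈ᴸ rules P ×
  Σ (Config _) λ l → Σ (Config _) λ r →
    (c ≡ l ++ src t ∷ r) × (c' ≡ l ++ tgt t ∷ r) × guardHolds (guard t) l r

_⊢_⟶ᴬ_ : ∀ {n} → ParamSystem n → Config n → Config n → Set
P ⊢ c ⟶ᴬ c' = Σ (Config _) λ d → (d ≼ c) × (P ⊢ d ⟶ c')

CSet : ℕ → Set₁
CSet n = Config n → Set

Pre : ∀ {n} → ParamSystem n → CSet n → CSet n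
Pre P U c = Σ (Config _) λ c' → U c' × (P ⊢ c ⟶ᴬ c')

Up : ∀ {n} → List (Config n) → CSet n
Up F c = Σ (Config _) λ w → w ∈ᴸ F × (w ≼ c)

Iter : ∀ {n} → ParamSystem n → List (Config n) → ℕ → CSet n
Iter P F 0       = Up F
Iter P F (suc i) = λ c → Iter P F i c ⊎ Pre P (Iter P F i) c

_≐_ : ∀ {n} → CSet n → CSet n → Set
U ≐ V = ∀ c → (U c → V c) × (V c → U c)

-- First-order structures for the vocabulary of Φ_P, Ψ_F.
-- Constants q ∈ Q, e; binary *; unary In, R; unary P^J (given for every
-- J; only those J occurring in ∀-conditions of T are constrained).

record Structure (n : ℕ) (M : Set) : Set₁ where
  field
    const : Fin n → M
    e     : M
    _*_   : M → M → M
    In    : M → Set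
    Rel   : M → Set
    PJ    : Subset n → M → Set

module _ {n : ℕ} {M : Set} (S : Structure n M) where
  open Structure S

  ForallJ : ParamSystem n → Subset n → Set
  ForallJ P J = Σ (Rule n) λ t → t ∈ᴸ rules P × Σ Side λ I → guard t ≡ just (all∀ I J)

  ruleAxiom : Rule n → Set
  ruleAxiom (rule nothing q₁ q₂) =
    ∀ x y → Rel ((x * const q₁) * y) → Rel ((x * const q₂) * y)
  ruleAxiom (rule (just (all∀ L J)) q₁ q₂) =
    ∀ x y → Rel ((x * const q₁) * y) → PJ J x → Rel ((x * const q₂) * y)
  ruleAxiom (rule (just (all∀ R J)) q₁ q₂) =
    ∀ x y → Rel ((x * const q₁) * y) → PJ J y → Rel ((x * const q₂) * y)
  ruleAxiom (rule (just (all∀ LR J)) q₁ q₂) =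
    ∀ x y → Rel ((x * const q₁) * y) → PJ J x × PJ J y → Rel ((x * const q₂) * y)
  ruleAxiom (rule (just (ex∃ L J)) q₁ q₂) =
    ∀ q → q ∈ J → ∀ x y z w →
      Rel ((x * const q₁) * y) × (x ≡ (z * const q) * w) → Rel ((x * const q₂) * y)
  ruleAxiom (rule (just (ex∃ R J)) q₁ q₂) =
    ∀ q → q ∈ J → ∀ x y z w →
      Rel ((x * const q₁) * y) × (y ≡ (z * const q) * w) → Rel ((x * const q₂) * y)
  ruleAxiom (rule (just (ex∃ LR J)) q₁ q₂) =
    ∀ q → q ∈ J → ∀ x y z w →
      Rel ((x * const q₁) * y) × ((x ≡ (z * const q) * w) ⊎ (y ≡ (z * const q) * w))
      → Rel ((x * const q₂) * y)

  record ModelsΦ (P : ParamSystem n) (q₀ : Fin n) : Set where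
    field
      assoc  : ∀ x y z → (x * y) * z ≡ x * (y * z)
      unitˡ  : ∀ x → e * x ≡ x
      unitʳ  : ∀ x → x * e ≡ x
      in-e   : In e
      in-q₀  : ∀ x → In x → In (x * const q₀)
      in-R   : ∀ x → In x → Rel x
      pJ-e   : ∀ J → ForallJ P J → PJ J e
      pJ-q   : ∀ J → ForallJ P J → ∀ q → q ∈ J → ∀ x → PJ J x → PJ J (x * const q)
      rulesA : ∀ t → t ∈ᴸ rules P → ruleAxiom t

  -- The term  x₀ * w₁ * x₁ * ⋯ * wₖ * xₖ  (bracketed to the right;
  -- bracketing is immaterial under associativity)
  wordTerm : (w : Config n) → (Fin (suc (length w)) → M) → M
  wordTerm []      xs = xs zero
  wordTerm (q ∷ w) xs = (xs zero * const q) * wordTerm w (λ i → xs (suc i))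

  ModelsNotΨ : List (Config n) → Set
  ModelsNotΨ F = ∀ w → w ∈ᴸ F → ∀ (xs : Fin (suc (length w)) → M) → ¬ Rel (wordTerm w xs)

FiniteModel : ∀ {n} → ParamSystem n → Fin n → List (Config n) → Set₁
FiniteModel {n} P q₀ F =
  Σ ℕ λ m → Σ (Structure n (Fin m)) λ S → ModelsΦ S P q₀ × ModelsNotΨ S F

module Submission where

-- Every U_i is upward closed for the subword ordering and has
-- a small basis: each  c ∈ U_i  lies above some  c₀ ∈ U_i  of length at most
-- maxLength F + 2i  (a guard only needs to keep one witness letter).  Let N
-- exceed this bound for  i = k  by one.  The model is the monoid of nonempty
-- down-sets of words of length ≤ N under concatenation truncated at length N;
-- a letter q denotes  {[] , [q]}.  R(X) holds iff X misses U, In(X) iff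
-- X ⊆ q₀*, and P^J(X) iff X ⊆ J*.  A rule axiom holds because U is closed
-- under Pre and a counterexample may be taken in the small basis, which
-- leaves room for the one extra letter witnessing an ∃-guard.  ¬Ψ_F holds
-- since the word term of  w ∈ F  denotes a language containing  w ∈ U.

open import Defs
open import Data.Nat using (ℕ; zero; suc; _+_; _*_; _^_; _≤_; _<_; z≤n; s≤s; _⊔_; _≤?_)
open import Data.Nat.Properties
  using (≤-refl; ≤-trans; ≤-reflexive; n≤1+n; m≤m+n; m≤n+m; m≤m⊔n; m≤n⊔m; +-suc; +-monoˡ-≤; +-monoʳ-≤; ≰⇒>; module ≤-Reasoning)
open import Data.Fin using (Fin; zero; suc)
open import Data.Fin.Properties using (_≟_; 2↔Bool; *↔×; +↔⊎)
open import Data.Bool using (Bool; true; false; _∧_; _∨_; T)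
open import Data.Bool.Properties using (T-∧; T-∨; T-irrelevant; T?)
open import Data.Vec using (Vec; lookup; tabulate)
open import Data.Vec.Properties using (lookup∘tabulate; tabulate∘lookup; tabulate-cong)
open import Data.Vec.Recursive using (lift↔; Fin[m^n]↔Fin[m]^n)
open import Data.Vec.Recursive.Properties using (↔Vec)
open import Data.List using (List; []; _∷_; _++_; length; replicate; map; concatMap; allFin)
open import Data.List.Properties using (length-++; length-++-sucʳ; ++-assoc; ++-identityʳ)
open import Data.List.Relation.Unary.All as All using (All; []; _∷_)
open import Data.List.Relation.Unary.All.Properties using () renaming (++⁺ to All-++⁺)
open import Data.List.Relation.Unary.Any as Any using (Any; here; there)
open import Data.List.Relation.Unary.Any.Properties using () renaming (++⁺ʳ to Any-++⁺ʳ)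
open import Data.List.Membership.Propositional using () renaming (_∈_ to _∈ᴸ_)
open import Data.List.Membership.Propositional.Properties using (∈-map⁺; ∈-concatMap⁺; ∈-allFin)
open import Data.List.Relation.Binary.Sublist.Propositional using (_⊆_; []; _∷_; _∷ʳ_; ⊆-refl; ⊆-trans)
open import Data.List.Relation.Binary.Sublist.Propositional.Properties
  using (length-mono-≤; []⊆-universal; ++⁺; ++⁺ˡ; ++⁺ʳ; All-resp-⊆)
open import Data.Product using (Σ; ∃; ∃₂; _×_; _,_; proj₁; proj₂)
open import Data.Product.Properties using (Σ-≡,≡→≡)
open import Data.Product.Function.NonDependent.Propositional using (_×-↔_)
open import Data.Product.Function.Dependent.Propositional using (Σ-↔)
open import Data.Sum using (_⊎_; inj₁; inj₂)
open import Data.Sum.Function.Propositional using (_⊎-↔_)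
open import Data.Maybe using (Maybe; just; nothing)
open import Data.Unit using (tt)
open import Data.Empty using (⊥-elim)
open import Function using (_∘_)
open import Function.Bundles using (_↔_; mk↔ₛ′; Inverse; Equivalence)
open import Function.Properties.Inverse using (↔-refl; ↔-sym; ↔-trans)
open import Relation.Nullary using (Dec; yes; no; ¬_; Irrelevant)
open import Relation.Nullary.Decidable using (⌊_⌋; map′; _→-dec_; _×-dec_; True; toWitness; fromWitness)
open import Relation.Binary.PropositionalEquality
  using (_≡_; refl; sym; trans; cong; cong₂; subst; module ≡-Reasoning)

length-insert : ∀ {A : Set} (l : List A) x r → length (l ++ x ∷ r) ≡ suc (length l + length r)
length-insert l x r = trans (length-++ l) (+-suc (length l) (length r))

length-++ˡ : ∀ {A : Set} (u v : List A) → length u ≤ length (u ++ v)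
length-++ˡ u v = length-mono-≤ (++⁺ʳ v (⊆-refl {x = u}))

length-++ʳ : ∀ {A : Set} (u v : List A) → length v ≤ length (u ++ v)
length-++ʳ u v = length-mono-≤ (++⁺ˡ u (⊆-refl {x = v}))

module _ {A : Set} where

  ⊆-++-split : ∀ {w : List A} u v → w ⊆ u ++ v →
    ∃₂ λ u' v' → (w ≡ u' ++ v') × (u' ⊆ u) × (v' ⊆ v)
  ⊆-++-split []      v p = [] , _ , refl , [] , p
  ⊆-++-split (x ∷ u) v (.x ∷ʳ p) with ⊆-++-split u v p
  ... | u' , v' , eq , pu , pv = u' , v' , eq , x ∷ʳ pu , pv
  ⊆-++-split (x ∷ u) v (refl ∷ p) with ⊆-++-split u v p
  ... | u' , v' , refl , pu , pv = x ∷ u' , v' , refl , refl ∷ pu , pv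

  ⊆-around : ∀ {w : List A} l x r → w ⊆ l ++ x ∷ r →
    ∃₂ λ a b → (a ⊆ l) × (b ⊆ r) × (w ⊆ a ++ x ∷ b) × (length a + length b ≤ length w)
  ⊆-around l x r p with ⊆-++-split l (x ∷ r) p
  ... | a , _ ∷ b , refl , pa , (refl ∷ pb) =
    a , b , pa , pb , ⊆-refl , ≤-trans (n≤1+n _) (≤-reflexive (sym (length-insert a x b)))
  ... | a , b , refl , pa , (.x ∷ʳ pb) =
    a , b , pa , pb , ++⁺ (⊆-refl {x = a}) (x ∷ʳ ⊆-refl) , ≤-reflexive (sym (length-++ a))

  ⊆-witness : ∀ {P : A → Set} {a l : List A} → a ⊆ l → Any P l →
    ∃ λ a' → (a ⊆ a') × (a' ⊆ l) × Any P a' × (length a' ≤ suc (length a))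
  ⊆-witness (y ∷ʳ p) (here py) = y ∷ _ , y ∷ʳ ⊆-refl , refl ∷ p , here py , ≤-refl
  ⊆-witness (y ∷ʳ p) (there q) with ⊆-witness p q
  ... | a' , s₁ , s₂ , any , le = a' , s₁ , y ∷ʳ s₂ , any , le
  ⊆-witness (refl ∷ p) (here py) = _ ∷ _ , refl ∷ ⊆-refl , refl ∷ p , here py , n≤1+n _
  ⊆-witness (refl ∷ p) (there q) with ⊆-witness p q
  ... | a' , s₁ , s₂ , any , le = _ ∷ a' , refl ∷ s₁ , refl ∷ s₂ , there any , s≤s le

maxLength : ∀ {A : Set} → List (List A) → ℕ
maxLength []      = 0
maxLength (w ∷ F) = length w ⊔ maxLength F

maxLength-∈ : ∀ {A : Set} {w : List A} (F : List (List A)) → w ∈ᴸ F → length w ≤ maxLength F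
maxLength-∈ (w ∷ F) (here refl) = m≤m⊔n _ _
maxLength-∈ (w ∷ F) (there p)   = ≤-trans (maxLength-∈ F p) (m≤n⊔m _ _)

All≡⇒replicate : ∀ {A : Set} {q : A} (c : List A) → All (_≡ q) c → c ≡ replicate (length c) q
All≡⇒replicate []      []         = refl
All≡⇒replicate (a ∷ c) (refl ∷ p) = cong (a ∷_) (All≡⇒replicate c p)

T-ext : ∀ {x y} → (T x → T y) → (T y → T x) → x ≡ y
T-ext {true}  {true}  _ _ = refl
T-ext {true}  {false} f _ = ⊥-elim (f _)
T-ext {false} {true}  _ g = ⊥-elim (g _)
T-ext {false} {false} _ _ = refl

module BackwardReachability {n} (P : ParamSystem n) (F : List (Config n)) where

  U : ℕ → CSet n
  U = Iter P F

  Pre-step : ∀ {V : CSet n} {t l r} → t ∈ᴸ rules P → guardHolds (guard t) l r →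
    V (l ++ tgt t ∷ r) → Pre P V (l ++ src t ∷ r)
  Pre-step {t = t} {l} {r} t∈P g v = _ , v , _ , ⊆-refl , t , t∈P , l , r , refl , refl , g

  U-upward : ∀ i {c c'} → U i c → c ⊆ c' → U i c'
  U-upward zero    (w , w∈F , w⊆c) s = w , w∈F , ⊆-trans w⊆c s
  U-upward (suc i) (inj₁ u) s = inj₁ (U-upward i u s)
  U-upward (suc i) (inj₂ (c'' , u , d , d⊆c , step)) s = inj₂ (c'' , u , d , ⊆-trans d⊆c s , step)

  U₀⊆U : ∀ i {c} → U 0 c → U i c
  U₀⊆U zero    u = u
  U₀⊆U (suc i) u = inj₁ (U₀⊆U i u)

  -- Given a guard g holding in the context (l , r) and subwords a ⊆ l, b ⊆ r,
  -- a context (a' , b') between (a , b) and (l , r), at most one letter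
  -- longer than (a , b), in which g still holds: ∀-guards pass to subwords,
  -- an ∃-guard needs one witnessing letter to be kept.
  record GuardWitness (g : Maybe (Cond n)) (l r a b : Config n) : Set where
    field
      a' b'  : Config n
      a⊆a'   : a ⊆ a'
      a'⊆l   : a' ⊆ l
      b⊆b'   : b ⊆ b'
      b'⊆r   : b' ⊆ r
      length-bound : length a' + length b' ≤ suc (length a + length b)
      holds' : guardHolds g a' b'

  module _ {g : Maybe (Cond n)} {l r a b : Config n} (a⊆l : a ⊆ l) (b⊆r : b ⊆ r) where

    witness-same : guardHolds g a b → GuardWitness g l r a b
    witness-same h = record
      { a⊆a' = ⊆-refl ; a'⊆l = a⊆l ; b⊆b' = ⊆-refl ; b'⊆r = b⊆r
      ; length-bound = n≤1+n _ ; holds' = h }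

    witness-left : ∀ {Q : Fin n → Set} → Any Q l → (∀ {a'} → Any Q a' → guardHolds g a' b) →
      GuardWitness g l r a b
    witness-left any mk with ⊆-witness a⊆l any
    ... | a' , a⊆a' , a'⊆l , any' , le = record
      { a⊆a' = a⊆a' ; a'⊆l = a'⊆l ; b⊆b' = ⊆-refl ; b'⊆r = b⊆r
      ; length-bound = +-monoˡ-≤ (length b) le ; holds' = mk any' }

    witness-right : ∀ {Q : Fin n → Set} → Any Q r → (∀ {b'} → Any Q b' → guardHolds g a b') →
      GuardWitness g l r a b
    witness-right any mk with ⊆-witness b⊆r any
    ... | b' , b⊆b' , b'⊆r , any' , le = record
      { a⊆a' = ⊆-refl ; a'⊆l = a⊆l ; b⊆b' = b⊆b' ; b'⊆r = b'⊆r
      ; length-bound = ≤-trans (+-monoʳ-≤ (length a) le) (≤-reflexive (+-suc (length a) (length b)))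
      ; holds' = mk any' }

  shrink-guard : ∀ g {l r a b} → guardHolds g l r → a ⊆ l → b ⊆ r → GuardWitness g l r a b
  shrink-guard nothing            h        sa sb = witness-same sa sb tt
  shrink-guard (just (all∀ L  J)) h        sa sb = witness-same sa sb (All-resp-⊆ sa h)
  shrink-guard (just (all∀ R  J)) h        sa sb = witness-same sa sb (All-resp-⊆ sb h)
  shrink-guard (just (all∀ LR J)) (hl , hr) sa sb = witness-same sa sb (All-resp-⊆ sa hl , All-resp-⊆ sb hr)
  shrink-guard (just (ex∃  L  J)) h        sa sb = witness-left  sa sb h (λ any → any)
  shrink-guard (just (ex∃  R  J)) h        sa sb = witness-right sa sb h (λ any → any)
  shrink-guard (just (ex∃  LR J)) (inj₁ h) sa sb = witness-left  sa sb h inj₁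
  shrink-guard (just (ex∃  LR J)) (inj₂ h) sa sb = witness-right sa sb h inj₂

  -- Each backward step adds at most two letters to a minimal element.
  basisBound : ℕ → ℕ
  basisBound zero    = maxLength F
  basisBound (suc i) = 2 + basisBound i

  maxLength≤basisBound : ∀ i → maxLength F ≤ basisBound i
  maxLength≤basisBound zero    = ≤-refl
  maxLength≤basisBound (suc i) = ≤-trans (maxLength≤basisBound i) (m≤n+m _ 2)

  small-basis : ∀ i {c} → U i c → ∃ λ c₀ → (c₀ ⊆ c) × U i c₀ × (length c₀ ≤ basisBound i)
  small-basis zero (w , w∈F , w⊆c) = w , w⊆c , (w , w∈F , ⊆-refl) , maxLength-∈ F w∈F
  small-basis (suc i) (inj₁ u) with small-basis i u
  ... | c₀ , c₀⊆c , u₀ , le = c₀ , c₀⊆c , inj₁ u₀ , ≤-trans le (m≤n+m _ 2)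
  small-basis (suc i) (inj₂ (_ , u , d , d⊆c , t , t∈P , l , r , refl , refl , g))
    with small-basis i u
  ... | c₀ , c₀⊆ltr , u₀ , le₀ with ⊆-around l (tgt t) r c₀⊆ltr
  ... | a , b , a⊆l , b⊆r , c₀⊆atb , le-ab with shrink-guard (guard t) g a⊆l b⊆r
  ... | record { a' = a' ; b' = b' ; a⊆a' = a⊆a' ; a'⊆l = a'⊆l ; b⊆b' = b⊆b' ; b'⊆r = b'⊆r
               ; length-bound = le' ; holds' = g' } =
    a' ++ src t ∷ b' ,
    ⊆-trans (++⁺ a'⊆l (refl ∷ b'⊆r)) d⊆c ,
    inj₂ (Pre-step t∈P g' (U-upward i u₀ (⊆-trans c₀⊆atb (++⁺ a⊆a' (refl ∷ b⊆b'))))) ,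
    length-ok
    where
    open ≤-Reasoning
    length-ok : length (a' ++ src t ∷ b') ≤ 2 + basisBound i
    length-ok = begin
      length (a' ++ src t ∷ b')     ≡⟨ length-insert a' (src t) b' ⟩
      suc (length a' + length b')   ≤⟨ s≤s le' ⟩
      2 + (length a + length b)     ≤⟨ s≤s (s≤s (≤-trans le-ab le₀)) ⟩
      2 + basisBound i              ∎

  fixpoint-closed : ∀ k → U (suc k) ≐ U k → ∀ {c} → Pre P (U k) c → U k c
  fixpoint-closed k fix p = proj₁ (fix _) (inj₂ p)

Finite : Set → Set
Finite A = Σ ℕ λ m → A ↔ Fin m

finite-↔ : ∀ {A B} → A ↔ B → Finite B → Finite A
finite-↔ A↔B (m , B↔m) = m , ↔-trans A↔B B↔m

finite-Bool : Finite Bool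
finite-Bool = 2 , ↔-sym 2↔Bool

finite-× : ∀ {A B} → Finite A → Finite B → Finite (A × B)
finite-× (a , A↔a) (b , B↔b) = a * b , ↔-trans (A↔a ×-↔ B↔b) (↔-sym (*↔× {a} {b}))

finite-⊎ : ∀ {A B} → Finite A → Finite B → Finite (A ⊎ B)
finite-⊎ (a , A↔a) (b , B↔b) = a + b , ↔-trans (A↔a ⊎-↔ B↔b) (↔-sym (+↔⊎ {a} {b}))

finite-Vec : ∀ {A} → Finite A → ∀ k → Finite (Vec A k)
finite-Vec (a , A↔a) k =
  a ^ k , ↔-trans (↔-sym (↔Vec k)) (↔-trans (lift↔ k A↔a) (↔-sym (Fin[m^n]↔Fin[m]^n a k)))

finite-prop : ∀ {A} → Dec A → Irrelevant A → Finite A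
finite-prop (yes a) irr = 1 , mk↔ₛ′ (λ _ → zero) (λ _ → a) (λ { zero → refl }) (λ a' → irr a a')
finite-prop (no ¬a) irr = 0 , mk↔ₛ′ (λ a → ⊥-elim (¬a a)) (λ ()) (λ ()) (λ a → ⊥-elim (¬a a))

Σ-Fin-suc↔ : ∀ {K} (P : Fin (suc K) → Set) → Σ (Fin (suc K)) P ↔ (P zero ⊎ Σ (Fin K) (P ∘ suc))
Σ-Fin-suc↔ P = mk↔ₛ′ to from (λ { (inj₁ _) → refl ; (inj₂ _) → refl })
                           (λ { (zero , _) → refl ; (suc _ , _) → refl })
  where
  to : Σ _ P → _
  to (zero  , p) = inj₁ p
  to (suc i , p) = inj₂ (i , p)
  from : _ → Σ _ P
  from (inj₁ p)       = zero , p
  from (inj₂ (i , p)) = suc i , p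

finite-Σ-Fin : ∀ K (P : Fin K → Set) → (∀ i → Dec (P i)) → (∀ {i} → Irrelevant (P i)) →
  Finite (Σ (Fin K) P)
finite-Σ-Fin zero    P P? irr = 0 , mk↔ₛ′ (λ ()) (λ ()) (λ ()) (λ ())
finite-Σ-Fin (suc K) P P? irr = finite-↔ (Σ-Fin-suc↔ P)
  (finite-⊎ (finite-prop (P? zero) irr) (finite-Σ-Fin K (P ∘ suc) (P? ∘ suc) irr))

finite-Σ : ∀ {A} → Finite A → (P : A → Set) → (∀ a → Dec (P a)) → (∀ {a} → Irrelevant (P a)) →
  Finite (Σ A P)
finite-Σ (m , A↔m) P P? irr = finite-↔ (↔-sym (Σ-↔ (↔-sym A↔m) ↔-refl))
  (finite-Σ-Fin m (P ∘ from) (P? ∘ from) irr)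
  where open Inverse A↔m using (from)

module Languages (n : ℕ) where

  Word : Set
  Word = List (Fin n)

  -- A trie of depth N: a finite representation of a set of words of length ≤ N.
  Trie : ℕ → Set
  Trie zero    = Bool
  Trie (suc N) = Bool × Vec (Trie N) n

  finite-Trie : ∀ N → Finite (Trie N)
  finite-Trie zero    = finite-Bool
  finite-Trie (suc N) = finite-× finite-Bool (finite-Vec (finite-Trie N) n)

  member : ∀ {N} → Trie N → Word → Bool
  member {zero}  b        []      = b
  member {zero}  b        (_ ∷ _) = false
  member {suc N} (b , ts) []      = b
  member {suc N} (b , ts) (a ∷ w) = member (lookup ts a) w

  build : ∀ {N} → (Word → Bool) → Trie N
  build {zero}  f = f []
  build {suc N} f = f [] , tabulate (λ a → build (λ w → f (a ∷ w)))

  member-build : ∀ {N} f w → length w ≤ N → member {N} (build f) w ≡ f w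
  member-build {zero}  f []      _         = refl
  member-build {suc N} f []      _         = refl
  member-build {suc N} f (a ∷ w) (s≤s le) =
    trans (cong (λ t → member t w) (lookup∘tabulate (λ a → build {N} (λ w → f (a ∷ w))) a))
          (member-build (λ w → f (a ∷ w)) w le)

  member-long : ∀ {N} (t : Trie N) w → N < length w → member t w ≡ false
  member-long {zero}  t        (_ ∷ _) _        = refl
  member-long {suc N} (b , ts) (a ∷ w) (s≤s lt) = member-long (lookup ts a) w lt

  member-ext : ∀ {N} (t t' : Trie N) → (∀ w → length w ≤ N → member t w ≡ member t' w) → t ≡ t'
  member-ext {zero}  t        t'         eq = eq [] z≤n
  member-ext {suc N} (b , ts) (b' , ts') eq = cong₂ _,_ (eq [] z≤n)
    (trans (sym (tabulate∘lookup ts))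
      (trans (tabulate-cong (λ a → member-ext (lookup ts a) (lookup ts' a) (λ w le → eq (a ∷ w) (s≤s le))))
             (tabulate∘lookup ts')))

  splits : (Word → Bool) → (Word → Bool) → Word → Bool
  splits f g []      = f [] ∧ g []
  splits f g (a ∷ w) = (f [] ∧ g (a ∷ w)) ∨ splits (λ u → f (a ∷ u)) g w

  splits-sound : ∀ f g w → T (splits f g w) →
    ∃₂ λ u v → (w ≡ u ++ v) × T (f u) × T (g v)
  splits-sound f g [] p = [] , [] , refl , Equivalence.to T-∧ p
  splits-sound f g (a ∷ w) p with Equivalence.to (T-∨ {f [] ∧ g (a ∷ w)}) p
  ... | inj₁ q = [] , a ∷ w , refl , Equivalence.to T-∧ q
  ... | inj₂ q with splits-sound (λ u → f (a ∷ u)) g w q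
  ...   | u , v , refl , fu , gv = a ∷ u , v , refl , fu , gv

  splits-complete : ∀ f g u v → T (f u) → T (g v) → T (splits f g (u ++ v))
  splits-complete f g []      []      fu gv = Equivalence.from T-∧ (fu , gv)
  splits-complete f g []      (a ∷ v) fu gv =
    Equivalence.from (T-∨ {f [] ∧ g (a ∷ v)}) (inj₁ (Equivalence.from T-∧ (fu , gv)))
  splits-complete f g (a ∷ u) v       fu gv =
    Equivalence.from (T-∨ {f [] ∧ g (a ∷ u ++ v)}) (inj₂ (splits-complete (λ u → f (a ∷ u)) g u v fu gv))

  words : ℕ → List Word
  words zero    = [] ∷ []
  words (suc N) = [] ∷ concatMap (λ a → map (a ∷_) (words N)) (allFin n)

  words-complete : ∀ N (w : Word) → length w ≤ N → w ∈ᴸ words N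
  words-complete zero    []      _        = here refl
  words-complete (suc N) []      _        = here refl
  words-complete (suc N) (a ∷ w) (s≤s le) = there (∈-concatMap⁺ (λ a → map (a ∷_) (words N))
    (Any.map (λ { refl → ∈-map⁺ (a ∷_) (words-complete N w le) }) (∈-allFin a)))

  module Bounded (N : ℕ) where

    open import Data.List.Relation.Binary.Sublist.DecPropositional (_≟_ {n}) using (_⊆?_)

    Lang : Set
    Lang = Trie N

    -- Membership, wrapped in a record so that Y and w can be inferred from it.
    infix 4 _∋_
    record _∋_ (Y : Lang) (w : Word) : Set where
      constructor mem
      field is-member : T (member Y w)
    open _∋_

    _∋?_ : ∀ Y w → Dec (Y ∋ w)
    Y ∋? w = map′ mem is-member (T? (member Y w))

    ∋-length : ∀ {Y w} → Y ∋ w → length w ≤ N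
    ∋-length {Y} {w} (mem p) with length w ≤? N
    ... | yes le = le
    ... | no  gt = ⊥-elim (subst T (member-long Y w (≰⇒> gt)) p)

    ∋-build : ∀ {f w} → build f ∋ w → T (f w)
    ∋-build {f} {w} p = subst T (member-build f w (∋-length p)) (is-member p)

    build-∋ : ∀ {f w} → T (f w) → length w ≤ N → build f ∋ w
    build-∋ {f} {w} p le = mem (subst T (sym (member-build f w le)) p)

    Lang-ext : ∀ {X Y} → (∀ {w} → X ∋ w → Y ∋ w) → (∀ {w} → Y ∋ w → X ∋ w) → X ≡ Y
    Lang-ext {X} {Y} f g = member-ext X Y (λ w _ → T-ext (is-member ∘ f ∘ mem) (is-member ∘ g ∘ mem))

    -- Concatenation, truncated to words of length ≤ N.
    infixl 7 _·_
    opaque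
      _·_ : Lang → Lang → Lang
      X · Y = build (splits (member X) (member Y))

      ·-elim : ∀ {X Y w} → X · Y ∋ w → ∃₂ λ u v → (w ≡ u ++ v) × (X ∋ u) × (Y ∋ v)
      ·-elim {X} {Y} {w} p with splits-sound (member X) (member Y) w (∋-build p)
      ... | u , v , eq , pu , pv = u , v , eq , mem pu , mem pv

      ·-intro : ∀ {X Y u v} → X ∋ u → Y ∋ v → length (u ++ v) ≤ N → X · Y ∋ u ++ v
      ·-intro {X} {Y} {u} {v} pu pv le =
        build-∋ (splits-complete (member X) (member Y) u v (is-member pu) (is-member pv)) le

    ·-assoc : ∀ X Y Z → (X · Y) · Z ≡ X · (Y · Z)
    ·-assoc X Y Z = Lang-ext to from
      where
      to : ∀ {w} → (X · Y) · Z ∋ w → X · (Y · Z) ∋ w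
      to p with ·-elim p
      ... | _ , v , refl , p₁ , pv with ·-elim p₁
      ... | u , u' , refl , pu , pu' =
        let le = subst (λ x → length x ≤ N) (++-assoc u u' v) (∋-length p) in
        subst (X · (Y · Z) ∋_) (sym (++-assoc u u' v))
          (·-intro pu (·-intro pu' pv (≤-trans (length-++ʳ u (u' ++ v)) le)) le)
      from : ∀ {w} → X · (Y · Z) ∋ w → (X · Y) · Z ∋ w
      from p with ·-elim p
      ... | u , _ , refl , pu , p₁ with ·-elim p₁
      ... | u' , v , refl , pu' , pv =
        let le = subst (λ x → length x ≤ N) (sym (++-assoc u u' v)) (∋-length p) in
        subst ((X · Y) · Z ∋_) (++-assoc u u' v)
          (·-intro (·-intro pu pu' (≤-trans (length-++ˡ (u ++ u') v) le)) pv le)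

    opaque
      ↓ : Word → Lang
      ↓ c = build (λ w → ⌊ w ⊆? c ⌋)

      ↓-elim : ∀ {c w} → ↓ c ∋ w → w ⊆ c
      ↓-elim {c} {w} p = toWitness (∋-build p)

      ↓-intro : ∀ {c w} → w ⊆ c → length w ≤ N → ↓ c ∋ w
      ↓-intro {c} {w} s le = build-∋ (fromWitness s) le

    ε : Lang
    ε = ↓ []

    ε-elim : ∀ {w} → ε ∋ w → w ≡ []
    ε-elim p with ↓-elim p
    ... | [] = refl

    ε-intro : ε ∋ []
    ε-intro = ↓-intro [] z≤n

    ·-identityˡ : ∀ Y → ε · Y ≡ Y
    ·-identityˡ Y = Lang-ext to (λ p → ·-intro ε-intro p (∋-length p))
      where
      to : ∀ {w} → ε · Y ∋ w → Y ∋ w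
      to p with ·-elim p
      ... | u , v , refl , pu , pv rewrite ε-elim pu = pv

    ·-identityʳ : ∀ Y → Y · ε ≡ Y
    ·-identityʳ Y = Lang-ext to from
      where
      to : ∀ {w} → Y · ε ∋ w → Y ∋ w
      to p with ·-elim p
      ... | u , v , refl , pu , pv rewrite ε-elim pv | ++-identityʳ u = pu
      from : ∀ {w} → Y ∋ w → Y · ε ∋ w
      from {w} p = subst (Y · ε ∋_) (++-identityʳ w)
        (·-intro p ε-intro (subst (λ x → length x ≤ N) (sym (++-identityʳ w)) (∋-length p)))

    -- Nonempty down-sets of the subword ordering (nonempty iff they contain []).
    DownClosed : Lang → Set
    DownClosed Y = ∀ {w w'} → w' ⊆ w → Y ∋ w → Y ∋ w'

    Downset : Lang → Set
    Downset Y = DownClosed Y × Y ∋ []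

    downset-↓ : ∀ c → Downset (↓ c)
    downset-↓ c = (λ s p → ↓-intro (⊆-trans s (↓-elim p)) (≤-trans (length-mono-≤ s) (∋-length p)))
                , ↓-intro ([]⊆-universal c) z≤n

    downset-· : ∀ {X Y} → Downset X → Downset Y → Downset (X · Y)
    downset-· {X} {Y} (closedX , εX) (closedY , εY) = closed , ·-intro εX εY z≤n
      where
      closed : DownClosed (X · Y)
      closed s p with ·-elim p
      ... | u , v , refl , pu , pv with ⊆-++-split u v s
      ... | u' , v' , refl , su , sv =
        ·-intro (closedX su pu) (closedY sv pv) (≤-trans (length-mono-≤ s) (∋-length p))

    -- Being a down-set is decidable: it suffices to check words of length ≤ N.
    downset? : ∀ Y → Dec (All (λ w → All (λ w' → w' ⊆ w → Y ∋ w → Y ∋ w') (words N)) (words N) × Y ∋ [])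
    downset? Y = All.all? (λ w → All.all? (λ w' → (w' ⊆? w) →-dec (Y ∋? w →-dec Y ∋? w'))
                   (words N)) (words N)
               ×-dec Y ∋? []

    IsDownset : Lang → Set
    IsDownset Y = True (downset? Y)

    IsDownset-irrelevant : ∀ {Y} (p q : IsDownset Y) → p ≡ q
    IsDownset-irrelevant = T-irrelevant

    IsDownset⇒Downset : ∀ {Y} → IsDownset Y → Downset Y
    IsDownset⇒Downset {Y} d with toWitness {a? = downset? Y} d
    ... | closed , εY = (λ {w} {w'} s p → All.lookup (All.lookup closed (words-complete N w (∋-length p)))
                                            (words-complete N w' (≤-trans (length-mono-≤ s) (∋-length p))) s p)
                      , εY

    Downset⇒IsDownset : ∀ {Y} → Downset Y → IsDownset Y
    Downset⇒IsDownset {Y} (closed , εY) =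
      fromWitness {a? = downset? Y} (All.tabulate (λ _ → All.tabulate (λ _ → closed)) , εY)

    ↓[_] : Fin n → Lang
    ↓[ q ] = ↓ (q ∷ [])

    letter-intro : ∀ {X Y u s} q → X ∋ u → Y ∋ s → length (u ++ q ∷ s) ≤ N →
      X · ↓[ q ] · Y ∋ u ++ q ∷ s
    letter-intro {X} {Y} {u} {s} q pu ps le =
      subst (X · ↓[ q ] · Y ∋_) (++-assoc u (q ∷ []) s)
        (·-intro (·-intro pu pq (≤-trans (length-++ˡ (u ++ q ∷ []) s) le′)) ps le′)
      where
      le′ : length ((u ++ q ∷ []) ++ s) ≤ N
      le′ = subst (λ x → length x ≤ N) (sym (++-assoc u (q ∷ []) s)) le
      pq : ↓[ q ] ∋ q ∷ []
      pq = ↓-intro ⊆-refl (≤-trans (s≤s z≤n) (≤-trans (length-++ʳ u (q ∷ s)) le))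

    letter-skip : ∀ {X Y u s} q → X ∋ u → Y ∋ s → length (u ++ s) ≤ N → X · ↓[ q ] · Y ∋ u ++ s
    letter-skip {X} {Y} {u} {s} q pu ps le =
      subst (λ x → X · ↓[ q ] · Y ∋ x ++ s) (++-identityʳ u)
        (·-intro (·-intro pu (↓-intro (q ∷ʳ []) z≤n) (≤-trans (length-++ˡ (u ++ []) s) le′)) ps le′)
      where
      le′ : length ((u ++ []) ++ s) ≤ N
      le′ = subst (λ x → length (x ++ s) ≤ N) (sym (++-identityʳ u)) le

    letter-elim : ∀ {X Y c} q → X · ↓[ q ] · Y ∋ c →
      ∃₂ λ u s → (X ∋ u) × (Y ∋ s) × ((c ≡ u ++ s) ⊎ (c ≡ u ++ q ∷ s))
    letter-elim q p with ·-elim p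
    ... | _ , s , refl , p₁ , ps with ·-elim p₁
    ... | u , v , refl , pu , pv with ↓-elim pv
    ... | _ ∷ʳ [] = u , s , pu , ps , inj₁ (cong (_++ s) (++-identityʳ u))
    ... | refl ∷ [] = u , s , pu , ps , inj₂ (++-assoc u (q ∷ []) s)

    letter-witness : ∀ {X Y u} q → X · ↓[ q ] · Y ∋ u → length u < N →
      ∃ λ u' → (X · ↓[ q ] · Y ∋ u') × (u ⊆ u') × (length u' ≤ suc (length u)) × Any (_≡ q) u'
    letter-witness q p lt with letter-elim q p
    ... | a , b , pa , pb , inj₁ refl =
      a ++ q ∷ b , letter-intro q pa pb (subst (_≤ N) (sym (length-++-sucʳ a q b)) lt) ,
      ++⁺ (⊆-refl {x = a}) (q ∷ʳ ⊆-refl) , ≤-reflexive (length-++-sucʳ a q b) , Any-++⁺ʳ a (here refl)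
    ... | a , b , pa , pb , inj₂ refl = _ , p , ⊆-refl , n≤1+n _ , Any-++⁺ʳ a (here refl)

module CounterModel {n} (P : ParamSystem n) (q₀ : Fin n) (F : List (Config n)) (k : ℕ)
    (fixpoint : Iter P F (suc k) ≐ Iter P F k)
    (init-safe : ∀ j → ¬ Iter P F k (replicate j q₀)) where

  open BackwardReachability P F
  open Languages n

  -- Words up to one letter longer than the small basis of the fixpoint.
  N : ℕ
  N = suc (basisBound k)

  open Bounded N

  Reach : CSet n
  Reach = U k

  Elem : Set
  Elem = Σ Lang IsDownset

  -- The enumeration is opaque, and the carrier  Fin m  is
  -- related to Elem only through the equations of the bijection below, so
  -- that type checking never unfolds the enumeration.
  opaque
    finite-Elem : Finite Elem
    finite-Elem = finite-Σ (finite-Trie N) IsDownset (λ X → T? _) (λ {X} → IsDownset-irrelevant {X})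

  opaque
    m : ℕ
    m = proj₁ finite-Elem

    open Inverse (proj₂ finite-Elem) using (to; from; strictlyInverseˡ; strictlyInverseʳ)

    ⟦_⟧ : Fin m → Lang
    ⟦ i ⟧ = proj₁ (from i)

    ⟦⟧-downset : ∀ i → Downset ⟦ i ⟧
    ⟦⟧-downset i = IsDownset⇒Downset (proj₂ (from i))

    ⟦⟧-injective : ∀ {i j} → ⟦ i ⟧ ≡ ⟦ j ⟧ → i ≡ j
    ⟦⟧-injective {i} {j} eq = begin
      i             ≡⟨ sym (strictlyInverseˡ i) ⟩
      to (from i)   ≡⟨ cong to (Σ-≡,≡→≡ (eq , IsDownset-irrelevant _ _)) ⟩
      to (from j)   ≡⟨ strictlyInverseˡ j ⟩
      j             ∎
      where open ≡-Reasoning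

    elem : (X : Lang) → Downset X → Fin m
    elem X d = to (X , Downset⇒IsDownset d)

    ⟦elem⟧ : ∀ X d → ⟦ elem X d ⟧ ≡ X
    ⟦elem⟧ X d = cong proj₁ (strictlyInverseʳ (X , Downset⇒IsDownset d))

  _⊛_ : Fin m → Fin m → Fin m
  i ⊛ j = elem (⟦ i ⟧ · ⟦ j ⟧) (downset-· (⟦⟧-downset i) (⟦⟧-downset j))

  letter : Fin n → Fin m
  letter q = elem ↓[ q ] (downset-↓ (q ∷ []))

  unit : Fin m
  unit = elem ε (downset-↓ [])

  ⟦⊛⟧ : ∀ i j → ⟦ i ⊛ j ⟧ ≡ ⟦ i ⟧ · ⟦ j ⟧
  ⟦⊛⟧ i j = ⟦elem⟧ _ _

  ⟦unit⟧ : ⟦ unit ⟧ ≡ ε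
  ⟦unit⟧ = ⟦elem⟧ _ _

  ⟦suffix⟧ : ∀ x q → ⟦ x ⊛ letter q ⟧ ≡ ⟦ x ⟧ · ↓[ q ]
  ⟦suffix⟧ x q = trans (⟦⊛⟧ x _) (cong (⟦ x ⟧ ·_) (⟦elem⟧ _ _))

  ⟦context⟧ : ∀ x q y → ⟦ (x ⊛ letter q) ⊛ y ⟧ ≡ ⟦ x ⟧ · ↓[ q ] · ⟦ y ⟧
  ⟦context⟧ x q y = trans (⟦⊛⟧ _ y) (cong (_· ⟦ y ⟧) (⟦suffix⟧ x q))

  Hits : Lang → Set
  Hits X = ∃ λ c → X ∋ c × Reach c

  AllWords : (Fin n → Set) → Lang → Set
  AllWords Q X = ∀ {w} → X ∋ w → All Q w

  S : Structure n (Fin m)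
  S = record
    { const = letter ; e = unit ; _*_ = _⊛_
    ; In  = λ i → AllWords (_≡ q₀) ⟦ i ⟧
    ; Rel = λ i → ¬ Hits ⟦ i ⟧
    ; PJ  = λ J i → AllWords (InJ J) ⟦ i ⟧ }

  ⊛-assoc : ∀ x y z → (x ⊛ y) ⊛ z ≡ x ⊛ (y ⊛ z)
  ⊛-assoc x y z = ⟦⟧-injective (begin
    ⟦ (x ⊛ y) ⊛ z ⟧            ≡⟨ ⟦⊛⟧ _ z ⟩
    ⟦ x ⊛ y ⟧ · ⟦ z ⟧          ≡⟨ cong (_· ⟦ z ⟧) (⟦⊛⟧ x y) ⟩
    ⟦ x ⟧ · ⟦ y ⟧ · ⟦ z ⟧      ≡⟨ ·-assoc ⟦ x ⟧ ⟦ y ⟧ ⟦ z ⟧ ⟩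
    ⟦ x ⟧ · (⟦ y ⟧ · ⟦ z ⟧)    ≡⟨ cong (⟦ x ⟧ ·_) (sym (⟦⊛⟧ y z)) ⟩
    ⟦ x ⟧ · ⟦ y ⊛ z ⟧          ≡⟨ sym (⟦⊛⟧ x _) ⟩
    ⟦ x ⊛ (y ⊛ z) ⟧            ∎)
    where open ≡-Reasoning

  ⊛-identityˡ : ∀ x → unit ⊛ x ≡ x
  ⊛-identityˡ x = ⟦⟧-injective (trans (⟦⊛⟧ unit x) (trans (cong (_· ⟦ x ⟧) ⟦unit⟧) (·-identityˡ ⟦ x ⟧)))

  ⊛-identityʳ : ∀ x → x ⊛ unit ≡ x
  ⊛-identityʳ x = ⟦⟧-injective (trans (⟦⊛⟧ x unit) (trans (cong (⟦ x ⟧ ·_) ⟦unit⟧) (·-identityʳ ⟦ x ⟧)))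

  AllWords-unit : ∀ {Q} → AllWords Q ⟦ unit ⟧
  AllWords-unit {Q} p = subst (All Q) (sym (ε-elim (subst (_∋ _) ⟦unit⟧ p))) []

  AllWords-suffix : ∀ {Q} x q → Q q → AllWords Q ⟦ x ⟧ → AllWords Q ⟦ x ⊛ letter q ⟧
  AllWords-suffix {Q} x q Qq all-x {w} p =
    let (u , v , w≡uv , pu , pv) = ·-elim (subst (_∋ w) (⟦suffix⟧ x q) p)
    in subst (All Q) (sym w≡uv) (All-++⁺ (all-x pu) (All-resp-⊆ (↓-elim pv) (Qq ∷ [])))

  initial-safe : ∀ x → AllWords (_≡ q₀) ⟦ x ⟧ → ¬ Hits ⟦ x ⟧
  initial-safe x all-q₀ (c , pc , rc) = init-safe (length c) (subst Reach (All≡⇒replicate c (all-q₀ pc)) rc)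

  fire : ∀ {t l r} → t ∈ᴸ rules P → guardHolds (guard t) l r →
    Reach (l ++ tgt t ∷ r) → Reach (l ++ src t ∷ r)
  fire t∈P g reach = fixpoint-closed k fixpoint (Pre-step t∈P g reach)

  -- What a rule axiom for  q₁ → q₂  needs in the contexts X, Y: from every
  -- short reachable  u q₂ s  with u ∈ X, s ∈ Y, reach a word of  X q₁ Y.
  Transfers : Lang → Lang → Fin n → Fin n → Set
  Transfers X Y q₁ q₂ = ∀ {u s} → X ∋ u → Y ∋ s → Reach (u ++ q₂ ∷ s) →
    suc (length u + length s) ≤ basisBound k → Hits (X · ↓[ q₁ ] · Y)

  -- Thanks to the small basis it suffices to consider short words.
  transfer : ∀ {X Y q₁ q₂} → Downset X → Downset Y → Transfers X Y q₁ q₂ →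
    Hits (X · ↓[ q₂ ] · Y) → Hits (X · ↓[ q₁ ] · Y)
  transfer {q₁ = q₁} {q₂} dX dY tr (c , pc , reach) with small-basis k reach
  ... | c₀ , c₀⊆c , reach₀ , le₀
    with letter-elim q₂ (proj₁ (downset-· (downset-· dX (downset-↓ _)) dY) c₀⊆c pc)
  ... | u , s , pu , ps , inj₁ refl = u ++ s , letter-skip q₁ pu ps (≤-trans le₀ (n≤1+n _)) , reach₀
  ... | u , s , pu , ps , inj₂ refl = tr pu ps reach₀ (subst (_≤ basisBound k) (length-insert u q₂ s) le₀)

  fire-enlarged : ∀ {X Y t u s u' s'} → t ∈ᴸ rules P → X ∋ u' → Y ∋ s' → u ⊆ u' → s ⊆ s' →
    length u' + length s' ≤ basisBound k → guardHolds (guard t) u' s' →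
    Reach (u ++ tgt t ∷ s) → Hits (X · ↓[ src t ] · Y)
  fire-enlarged {t = t} {u' = u'} {s' = s'} t∈P pu' ps' u⊆u' s⊆s' le g reach =
    u' ++ src t ∷ s' ,
    letter-intro (src t) pu' ps' (subst (_≤ N) (sym (length-insert u' (src t) s')) (s≤s le)) ,
    fire t∈P g (U-upward k reach (++⁺ u⊆u' (refl ∷ s⊆s')))

  transfer-everywhere : ∀ {X Y t} → t ∈ᴸ rules P →
    (∀ {u s} → X ∋ u → Y ∋ s → guardHolds (guard t) u s) → Transfers X Y (src t) (tgt t)
  transfer-everywhere t∈P g pu ps reach le =
    fire-enlarged t∈P pu ps ⊆-refl ⊆-refl (≤-trans (n≤1+n _) le) (g pu ps) reach

  transfer-∃ˡ : ∀ {Z W Y t q} {Q : Fin n → Set} → t ∈ᴸ rules P → Q q →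
    (∀ {u s} → Any Q u → guardHolds (guard t) u s) → Transfers (Z · ↓[ q ] · W) Y (src t) (tgt t)
  transfer-∃ˡ {q = q} t∈P Qq g {s = s} pu ps reach le
    with letter-witness q pu (s≤s (≤-trans (m≤m+n _ _) (≤-trans (n≤1+n _) le)))
  ... | u' , pu' , u⊆u' , le' , any =
    fire-enlarged t∈P pu' ps u⊆u' ⊆-refl (≤-trans (+-monoˡ-≤ (length s) le') le)
      (g (Any.map (λ { refl → Qq }) any)) reach

  transfer-∃ʳ : ∀ {X Z W t q} {Q : Fin n → Set} → t ∈ᴸ rules P → Q q →
    (∀ {u s} → Any Q s → guardHolds (guard t) u s) → Transfers X (Z · ↓[ q ] · W) (src t) (tgt t)
  transfer-∃ʳ {q = q} t∈P Qq g {u} {s} pu ps reach le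
    with letter-witness q ps (s≤s (≤-trans (m≤n+m _ _) (≤-trans (n≤1+n _) le)))
  ... | s' , ps' , s⊆s' , le' , any =
    fire-enlarged t∈P pu ps' ⊆-refl s⊆s'
      (≤-trans (+-monoʳ-≤ (length u) le') (≤-trans (≤-reflexive (+-suc (length u) (length s))) le))
      (g (Any.map (λ { refl → Qq }) any)) reach

  axiom : ∀ x y {q₁ q₂} → Transfers ⟦ x ⟧ ⟦ y ⟧ q₁ q₂ →
    ¬ Hits ⟦ (x ⊛ letter q₁) ⊛ y ⟧ → ¬ Hits ⟦ (x ⊛ letter q₂) ⊛ y ⟧
  axiom x y {q₁} {q₂} tr ¬hit hit = ¬hit (subst Hits (sym (⟦context⟧ x q₁ y))
    (transfer (⟦⟧-downset x) (⟦⟧-downset y) tr (subst Hits (⟦context⟧ x q₂ y) hit)))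

  ⟦context⟧≡ : ∀ {x z q w} → x ≡ (z ⊛ letter q) ⊛ w → ⟦ x ⟧ ≡ ⟦ z ⟧ · ↓[ q ] · ⟦ w ⟧
  ⟦context⟧≡ {z = z} {q} {w} refl = ⟦context⟧ z q w

  rule-axiom : ∀ t → t ∈ᴸ rules P → ruleAxiom S t
  rule-axiom (rule nothing q₁ q₂) t∈P x y =
    axiom x y (transfer-everywhere t∈P (λ _ _ → tt))
  rule-axiom (rule (just (all∀ L J)) q₁ q₂) t∈P x y ¬hit Px =
    axiom x y (transfer-everywhere t∈P (λ pu _ → Px pu)) ¬hit
  rule-axiom (rule (just (all∀ R J)) q₁ q₂) t∈P x y ¬hit Py =
    axiom x y (transfer-everywhere t∈P (λ _ ps → Py ps)) ¬hit
  rule-axiom (rule (just (all∀ LR J)) q₁ q₂) t∈P x y ¬hit (Px , Py) =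
    axiom x y (transfer-everywhere t∈P (λ pu ps → Px pu , Py ps)) ¬hit
  rule-axiom (rule (just (ex∃ L J)) q₁ q₂) t∈P q q∈J x y z w (¬hit , x≡zqw) =
    axiom x y (subst (λ X → Transfers X ⟦ y ⟧ q₁ q₂) (sym (⟦context⟧≡ x≡zqw))
      (transfer-∃ˡ t∈P q∈J (λ any → any))) ¬hit
  rule-axiom (rule (just (ex∃ R J)) q₁ q₂) t∈P q q∈J x y z w (¬hit , y≡zqw) =
    axiom x y (subst (λ X → Transfers ⟦ x ⟧ X q₁ q₂) (sym (⟦context⟧≡ y≡zqw))
      (transfer-∃ʳ t∈P q∈J (λ any → any))) ¬hit
  rule-axiom (rule (just (ex∃ LR J)) q₁ q₂) t∈P q q∈J x y z w (¬hit , inj₁ x≡zqw) =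
    axiom x y (subst (λ X → Transfers X ⟦ y ⟧ q₁ q₂) (sym (⟦context⟧≡ x≡zqw))
      (transfer-∃ˡ t∈P q∈J inj₁)) ¬hit
  rule-axiom (rule (just (ex∃ LR J)) q₁ q₂) t∈P q q∈J x y z w (¬hit , inj₂ y≡zqw) =
    axiom x y (subst (λ X → Transfers ⟦ x ⟧ X q₁ q₂) (sym (⟦context⟧≡ y≡zqw))
      (transfer-∃ʳ t∈P q∈J inj₂)) ¬hit

  models-Φ : ModelsΦ S P q₀
  models-Φ = record
    { assoc  = ⊛-assoc
    ; unitˡ  = ⊛-identityˡ
    ; unitʳ  = ⊛-identityʳ
    ; in-e   = AllWords-unit
    ; in-q₀  = λ x → AllWords-suffix x q₀ refl
    ; in-R   = initial-safe
    ; pJ-e   = λ _ _ → AllWords-unit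
    ; pJ-q   = λ _ _ q q∈J x → AllWords-suffix x q q∈J
    ; rulesA = rule-axiom
    }

  -- The term  x₀ w₁ x₁ ⋯ wₖ xₖ  denotes a language containing  w₁ ⋯ wₖ,
  -- since every element contains [].
  wordTerm-∋ : ∀ w xs → length w ≤ N → ⟦ wordTerm S w xs ⟧ ∋ w
  wordTerm-∋ []      xs _  = proj₂ (⟦⟧-downset (xs zero))
  wordTerm-∋ (q ∷ w) xs le = subst (_∋ q ∷ w) (sym (⟦context⟧ (xs zero) q _))
    (letter-intro {u = []} q (proj₂ (⟦⟧-downset (xs zero)))
      (wordTerm-∋ w (xs ∘ suc) (≤-trans (n≤1+n _) le)) le)

  -- Each w ∈ F lies in U₀ ⊆ U_k, so no word term of F satisfies R.
  models-¬Ψ : ModelsNotΨ S F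
  models-¬Ψ w w∈F xs ¬hit = ¬hit
    (w , wordTerm-∋ w xs (≤-trans (maxLength-∈ F w∈F) (≤-trans (maxLength≤basisBound k) (n≤1+n _))) ,
     U₀⊆U k (w , w∈F , ⊆-refl))

  model : FiniteModel P q₀ F
  model = m , S , models-Φ , models-¬Ψ

theorem1 : ∀ {n} (P : ParamSystem n) (q₀ : Fin n) (F : List (Config n)) (k : ℕ) →
    (Iter P F (suc k) ≐ Iter P F k) →
    (∀ (j : ℕ) → ¬ Iter P F k (replicate j q₀)) →
    FiniteModel P q₀ F
theorem1 P q₀ F k fixpoint init-safe = CounterModel.model P q₀ F k fixpoint init-safe
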